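{- Average certificate complexity is neither an upper bound nor a lower bound on rank: there exist Boolean functions $f$ and $g$ such that $\mathrm{Rank}(f)<\mathrm{C}_{avg}(f)$ and $\mathrm{C}_{avg}(g)<\mathrm{Rank}(g)$.
   Context: For $a\in\{0,1\}^n$, $\mathrm{C}(f,a)$ is the minimum size of $S\subseteq[n]$ such that every $a'$ agreeing with $a$ on $S$ has $f(a')=f(a)$; $\mathrm{C}_{avg}(f)=2^{ -n}\sum_{a\in\{0,1\}^n}\mathrm{C}(f,a)$. A decision tree queries single variables and has $0/1$ leaves. Rank of a rooted binary tree: leaves have rank $0$; an internal node with children of ranks $a,b$ has rank $a+1$ if $a=b$, else $\max\{a,b\}$; $\mathrm{Rank}(f)$ is the minimum rank of a decision tree computing $f$. -}

module Defs where

open import Data.Bool using (Bool; true; false; not; _∧_; _∨_; if_then_else_)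
open import Data.Nat using (ℕ; zero; suc; _+_; _*_; _^_; _⊓_; _⊔_; _≤_; _≡ᵇ_)
open import Data.Nat.Properties using (m^n≢0)
open import Data.Fin using (Fin)
open import Data.List using (List; []; _∷_; map; concatMap; foldr; length; filter)
open import Data.Nat.ListAction using (sum)
open import Data.List.Base using (allFin)
open import Data.Integer using (+_)
open import Data.Rational using (ℚ; _/_)
open import Data.Product using (Σ; _×_)
open import Relation.Binary.PropositionalEquality using (_≡_)
import Data.Vec.Functional as VF

-- An input / assignment in {0,1}^n (false = 0, true = 1).
Input : ℕ → Set
Input n = Fin n → Bool

BoolFun : ℕ → Set
BoolFun n = Input n → Bool

SubsetN : ℕ → Set
SubsetN n = Fin n → Bool

size : ∀ {n} → SubsetN n → ℕ
size {n} S = length (filter (λ i → S i Data.Bool.≟ true) (allFin n))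
  where import Data.Bool

allInputs : ∀ n → List (Input n)
allInputs zero    = (λ ()) ∷ []
allInputs (suc n) = concatMap (λ b → map (λ x → b VF.∷ x) (allInputs n)) (true ∷ false ∷ [])

allSubsets : ∀ n → List (SubsetN n)
allSubsets = allInputs

all : ∀ {A : Set} → (A → Bool) → List A → Bool
all p = foldr (λ x r → p x ∧ r) true

eqB : Bool → Bool → Bool
eqB true  true  = true
eqB false false = true
eqB _     _     = false

agreesOn : ∀ {n} → SubsetN n → Input n → Input n → Bool
agreesOn {n} S a a' = all (λ i → not (S i) ∨ eqB (a' i) (a i)) (allFin n)

isCertificate : ∀ {n} → BoolFun n → Input n → SubsetN n → Bool
isCertificate {n} f a S =
  all (λ a' → not (agreesOn S a a') ∨ eqB (f a') (f a)) (allInputs n)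

-- C(f,a): minimum size of a certificate for f at a.
-- (The full set [n] is always a certificate, so n is a valid starting value.)
C : ∀ {n} → BoolFun n → Input n → ℕ
C {n} f a = foldr (λ S m → if isCertificate f a S then size S ⊓ m else m) n (allSubsets n)

sumC : ∀ {n} → BoolFun n → ℕ
sumC {n} f = sum (map (C f) (allInputs n))

Cavg : ∀ {n} → BoolFun n → ℚ
Cavg {n} f = (+ sumC f) / (2 ^ n)
  where instance _ = m^n≢0 2 n

data DTree (n : ℕ) : Set where
  leaf : Bool → DTree n
  node : Fin n → DTree n → DTree n → DTree n

eval : ∀ {n} → DTree n → Input n → Bool
eval (leaf b)       x = b
eval (node i t₀ t₁) x = if x i then eval t₁ x else eval t₀ x

computes : ∀ {n} → DTree n → BoolFun n → Set
computes T f = ∀ x → eval T x ≡ f x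

rankNode : ℕ → ℕ → ℕ
rankNode a b = if a ≡ᵇ b then suc a else a ⊔ b

rank : ∀ {n} → DTree n → ℕ
rank (leaf _)       = 0
rank (node _ t₀ t₁) = rankNode (rank t₀) (rank t₁)

IsRank : ∀ {n} → BoolFun n → ℕ → Set
IsRank f r = Σ (DTree _) (λ T → computes T f × rank T ≡ r)
           × (∀ T → computes T f → r ≤ rank T)

{-# OPTIONS --safe #-}
-- OR of two variables is computed by a rank-1 tree, and being non-constant it has rank exactly 1,
-- while its certificate complexities are 2, 1, 1, 1, so C_avg = 5/4.
-- For g = x₀ ∨ (x₁ ⊕ x₂) the certificate complexities sum to 4·1 + 2·2 + 2·3 = 14, so
-- C_avg = 7/4, while Rank(g) = 2: a tree of rank ≤ 1 has a leaf child at its root, so the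
-- function it computes is constant or constant on a half-cube {x | xᵢ = c}; fixing x₀ = 0
-- does not increase rank and leaves the parity x₁ ⊕ x₂, which is constant on no half-cube.
module Submission where

open import Defs
open import Data.Nat using (ℕ)
open import Data.Product using (Σ; _×_)
open import Data.Integer using (+_)
open import Data.Rational using (_<_; _/_)

open import Data.Bool using (Bool; true; false; T; _∨_; _xor_; if_then_else_)
open import Data.Bool.Properties using (not-¬; not-distribʳ-xor)
open import Data.Empty using (⊥-elim)
open import Data.Fin using (Fin; zero; suc; _≟_)
open import Data.Nat as ℕ using (zero; suc; z≤n; s≤s; s≤s⁻¹; _≡ᵇ_; _⊔_; _≤?_)
open import Data.Nat.Properties
  using ( ≡ᵇ⇒≡; ≡⇒≡ᵇ; ≤-refl; ≤-trans; <-≤-trans; <-irrefl; <⇒≱; ≰⇒>; <-cmp; n≤1+n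
        ; ⊔-idem; m≤m⊔n; m≤n⊔m; ⊔-mono-≤)
open import Data.Product using (_,_)
open import Data.Sum using (_⊎_; inj₁; inj₂; [_,_])
open import Data.Vec.Functional using (_∷_; []; updateAt)
open import Data.Vec.Functional.Properties using (updateAt-updates; updateAt-minimal)
open import Relation.Binary using (tri<; tri≈; tri>)
open import Relation.Binary.PropositionalEquality using (_≡_; _≢_; refl; sym; trans; cong; subst)
open import Relation.Nullary using (¬_; yes; no)
open import Relation.Nullary.Decidable using (toWitness)
open import Function using (const)
import Data.Rational as ℚ

rankNode-cases : ∀ a b → (a ≡ b × rankNode a b ≡ suc a) ⊎ (a ≢ b × rankNode a b ≡ a ⊔ b)
rankNode-cases a b with a ≡ᵇ b in eq
... | true  = inj₁ (≡ᵇ⇒≡ a b (subst T (sym eq) _) , refl)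
... | false = inj₂ (a≢b , refl)
  where a≢b : a ≢ b
        a≢b refl = subst T eq (≡⇒≡ᵇ a a refl)

⊔≤rankNode : ∀ a b → a ⊔ b ℕ.≤ rankNode a b
⊔≤rankNode a b with rankNode-cases a b
... | inj₁ (refl , eq) rewrite eq | ⊔-idem a = n≤1+n a
... | inj₂ (_ , eq) rewrite eq = ≤-refl

0<rankNode : ∀ a b → 0 ℕ.< rankNode a b
0<rankNode zero    zero    = s≤s z≤n
0<rankNode zero    (suc b) = s≤s z≤n
0<rankNode (suc a) b       = <-≤-trans (s≤s z≤n) (≤-trans (m≤m⊔n (suc a) b) (⊔≤rankNode (suc a) b))

rankNode-suc : ∀ a b → rankNode (suc a) (suc b) ≡ suc (rankNode a b)
rankNode-suc a b with a ≡ᵇ b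
... | true  = refl
... | false = refl

rankNode≤1 : ∀ a b → rankNode a b ℕ.≤ 1 → a ≡ 0 ⊎ b ≡ 0
rankNode≤1 zero    _       _ = inj₁ refl
rankNode≤1 (suc a) zero    _ = inj₂ refl
rankNode≤1 (suc a) (suc b) h rewrite rankNode-suc a b = ⊥-elim (<⇒≱ (0<rankNode a b) (s≤s⁻¹ h))

<⊔-of-distinct : ∀ {a m n} → a ℕ.≤ m → a ℕ.≤ n → m ≢ n → a ℕ.< m ⊔ n
<⊔-of-distinct {a} {m} {n} a≤m a≤n m≢n with <-cmp m n
... | tri< m<n _ _ = ≤-trans (<-≤-trans (s≤s a≤m) m<n) (m≤n⊔m m n)
... | tri≈ _ m≡n _ = ⊥-elim (m≢n m≡n)
... | tri> _ _ n<m = ≤-trans (<-≤-trans (s≤s a≤n) n<m) (m≤m⊔n m n)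

rankNode-mono : ∀ {a a′ b b′} → a ℕ.≤ a′ → b ℕ.≤ b′ → rankNode a b ℕ.≤ rankNode a′ b′
rankNode-mono {a} {a′} {b} {b′} a≤a′ b≤b′ with rankNode-cases a b
... | inj₂ (_ , eq) rewrite eq = ≤-trans (⊔-mono-≤ a≤a′ b≤b′) (⊔≤rankNode a′ b′)
... | inj₁ (refl , eq) rewrite eq with rankNode-cases a′ b′
...   | inj₁ (_ , eq′) rewrite eq′ = s≤s a≤a′
...   | inj₂ (a′≢b′ , eq′) rewrite eq′ = <⊔-of-distinct a≤a′ b≤b′ a′≢b′

setVar : ∀ {n} → Input n → Fin n → Bool → Input n
setVar x i b = updateAt x i (const b)

restrict : ∀ {n} → Fin n → Bool → DTree n → DTree n
restrict i b (leaf c) = leaf c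
restrict i b (node j t₀ t₁) with i ≟ j | b
... | yes _ | false = restrict i b t₀
... | yes _ | true  = restrict i b t₁
... | no _  | _     = node j (restrict i b t₀) (restrict i b t₁)

eval-restrict : ∀ {n} i b (t : DTree n) x → eval (restrict i b t) x ≡ eval t (setVar x i b)
eval-restrict i b (leaf c) x = refl
eval-restrict i b (node j t₀ t₁) x with i ≟ j | b
... | yes refl | false rewrite updateAt-updates i {const false} x = eval-restrict i false t₀ x
... | yes refl | true  rewrite updateAt-updates i {const true} x = eval-restrict i true t₁ x
... | no i≢j   | c     rewrite updateAt-minimal j i {const c} x (λ j≡i → i≢j (sym j≡i))
                             | eval-restrict i c t₀ x | eval-restrict i c t₁ x = refl

rank-restrict : ∀ {n} i b (t : DTree n) → rank (restrict i b t) ℕ.≤ rank t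
rank-restrict i b (leaf c) = z≤n
rank-restrict i b (node j t₀ t₁) with i ≟ j | b
... | yes _ | false = ≤-trans (rank-restrict i false t₀)
                        (≤-trans (m≤m⊔n (rank t₀) (rank t₁)) (⊔≤rankNode (rank t₀) (rank t₁)))
... | yes _ | true  = ≤-trans (rank-restrict i true t₁)
                        (≤-trans (m≤n⊔m (rank t₀) (rank t₁)) (⊔≤rankNode (rank t₀) (rank t₁)))
... | no _  | c     = rankNode-mono (rank-restrict i c t₀) (rank-restrict i c t₁)

restrict-computes : ∀ {n} {f : BoolFun n} i b t →
                    computes t f → computes (restrict i b t) (λ x → f (setVar x i b))
restrict-computes i b t t-f x = trans (eval-restrict i b t x) (t-f (setVar x i b))

Constant : ∀ {n} → BoolFun n → Set
Constant f = ∀ x y → f x ≡ f y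

ConstantOnLiteral : ∀ {n} → BoolFun n → Set
ConstantOnLiteral {n} f = Σ (Fin n) λ i → Σ Bool λ c → ∀ x y → x i ≡ c → y i ≡ c → f x ≡ f y

rank≡0⇒constant : ∀ {n} (t : DTree n) → rank t ≡ 0 → Constant (eval t)
rank≡0⇒constant (leaf c)       _   x y = refl
rank≡0⇒constant (node i t₀ t₁) r≡0 = ⊥-elim (<-irrefl (sym r≡0) (0<rankNode (rank t₀) (rank t₁)))

eval-node : ∀ {n} i (t₀ t₁ : DTree n) x → eval (node i t₀ t₁) x ≡ eval (if x i then t₁ else t₀) x
eval-node i t₀ t₁ x with x i
... | true  = refl
... | false = refl

rank≤1⇒constantOnLiteral : ∀ {n} {f : BoolFun n} t → computes t f → rank t ℕ.≤ 1 →
                           Constant f ⊎ ConstantOnLiteral f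
rank≤1⇒constantOnLiteral (leaf c) t-f _ = inj₁ λ x y → trans (sym (t-f x)) (t-f y)
rank≤1⇒constantOnLiteral {f = f} (node i t₀ t₁) t-f r≤1 =
  inj₂ ([ leafBranch false , leafBranch true ] (rankNode≤1 (rank t₀) (rank t₁) r≤1))
  where
  leafBranch : ∀ c → rank (if c then t₁ else t₀) ≡ 0 → ConstantOnLiteral f
  leafBranch c r≡0 = i , c , λ x y xᵢ≡c yᵢ≡c →
    trans (sym (on-branch xᵢ≡c))
          (trans (rank≡0⇒constant (if c then t₁ else t₀) r≡0 x y) (on-branch yᵢ≡c))
    where
    on-branch : ∀ {x} → x i ≡ c → eval (if c then t₁ else t₀) x ≡ f x
    on-branch {x} xᵢ≡c = trans (cong (λ v → eval (if v then t₁ else t₀) x) (sym xᵢ≡c))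
                               (trans (sym (eval-node i t₀ t₁ x)) (t-f x))

nonconstant⇒1≤rank : ∀ {n} {f : BoolFun n} t → ¬ Constant f → computes t f → 1 ℕ.≤ rank t
nonconstant⇒1≤rank (leaf c)       ¬const t-f = ⊥-elim (¬const λ x y → trans (sym (t-f x)) (t-f y))
nonconstant⇒1≤rank (node i t₀ t₁) _      _   = 0<rankNode (rank t₀) (rank t₁)

nonliteral⇒2≤rank : ∀ {n} {f : BoolFun n} t → ¬ Constant f → ¬ ConstantOnLiteral f →
                    computes t f → 2 ℕ.≤ rank t
nonliteral⇒2≤rank t ¬const ¬literal t-f with rank t ≤? 1
... | no  r≰1 = ≰⇒> r≰1
... | yes r≤1 = ⊥-elim ([ ¬const , ¬literal ] (rank≤1⇒constantOnLiteral t t-f r≤1))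

or₂ : BoolFun 2
or₂ x = x zero ∨ x (suc zero)

or₂-tree : DTree 2
or₂-tree = node zero (node (suc zero) (leaf false) (leaf true)) (leaf true)

or₂-tree-computes : computes or₂-tree or₂
or₂-tree-computes x with x zero | x (suc zero)
... | true  | _     = refl
... | false | true  = refl
... | false | false = refl

or₂-nonconstant : ¬ Constant or₂
or₂-nonconstant const with const (false ∷ false ∷ []) (true ∷ true ∷ [])
... | ()

isRank-or₂ : IsRank or₂ 1
isRank-or₂ = (or₂-tree , or₂-tree-computes , refl) , λ t → nonconstant⇒1≤rank t or₂-nonconstant

orXor : BoolFun 3
orXor x = x zero ∨ (x (suc zero) xor x (suc (suc zero)))

xor₁₂ : BoolFun 3
xor₁₂ x = x (suc zero) xor x (suc (suc zero))

xor₁₂-nonconstant : ¬ Constant xor₁₂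
xor₁₂-nonconstant const with const (false ∷ false ∷ false ∷ []) (false ∷ true ∷ false ∷ [])
... | ()

xor₁₂-not-constantOnLiteral : ¬ ConstantOnLiteral xor₁₂
xor₁₂-not-constantOnLiteral (zero , c , const) =
  not-¬ refl (const (c ∷ false ∷ false ∷ []) (c ∷ true ∷ false ∷ []) refl refl)
xor₁₂-not-constantOnLiteral (suc zero , c , const) =
  not-¬ refl (trans (const (false ∷ c ∷ false ∷ []) (false ∷ c ∷ true ∷ []) refl refl)
                    (sym (not-distribʳ-xor c false)))
xor₁₂-not-constantOnLiteral (suc (suc zero) , c , const) =
  not-¬ refl (const (false ∷ false ∷ c ∷ []) (false ∷ true ∷ c ∷ []) refl refl)

orXor-tree : DTree 3
orXor-tree = node zero (node (suc zero) (parity (leaf false) (leaf true)) (parity (leaf true) (leaf false)))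
                       (leaf true)
  where parity : DTree 3 → DTree 3 → DTree 3
        parity = node (suc (suc zero))

orXor-tree-computes : computes orXor-tree orXor
orXor-tree-computes x with x zero | x (suc zero) | x (suc (suc zero))
... | true  | _     | _     = refl
... | false | false | false = refl
... | false | false | true  = refl
... | false | true  | false = refl
... | false | true  | true  = refl

-- orXor with x₀ set to false is xor₁₂ definitionally.
orXor-2≤rank : ∀ t → computes t orXor → 2 ℕ.≤ rank t
orXor-2≤rank t t-g = ≤-trans (nonliteral⇒2≤rank (restrict zero false t)
                                xor₁₂-nonconstant xor₁₂-not-constantOnLiteral
                                (restrict-computes zero false t t-g))
                              (rank-restrict zero false t)

isRank-orXor : IsRank orXor 2
isRank-orXor = (orXor-tree , orXor-tree-computes , refl) , orXor-2≤rank

1<Cavg-or₂ : (+ 1) / 1 < Cavg or₂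
1<Cavg-or₂ = toWitness {a? = (+ 1) / 1 ℚ.<? Cavg or₂} _

Cavg-orXor<2 : Cavg orXor < (+ 2) / 1
Cavg-orXor<2 = toWitness {a? = Cavg orXor ℚ.<? (+ 2) / 1} _

lemma5p6 : Σ ℕ (λ n → Σ (BoolFun n) (λ f → Σ ℕ (λ r → IsRank f r × ((+ r) / 1) < Cavg f)))
         × Σ ℕ (λ m → Σ (BoolFun m) (λ g → Σ ℕ (λ r → IsRank g r × Cavg g < ((+ r) / 1))))
lemma5p6 = (2 , or₂ , 1 , isRank-or₂ , 1<Cavg-or₂)
         , (3 , orXor , 2 , isRank-orXor , Cavg-orXor<2)
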